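{- Let $n, N, k, m$ be positive integers with $k \leq m$, let $(\mathcal{S}, \mathcal{X})$ be an $(n, N, k, m)$-CBC, and let $c$ be an integer with $1 \leq c \leq k-1$. Let $A_k$ be the number of members of $\mathcal{X}$ of cardinality exactly $k$. Then $$N \;\geq\; nc - \frac{(k-c)(U_{m,k,c}-n)}{m-k+1} + \frac{(k-c)(m-k)}{m-k+1}A_k,$$ where $U_{m,k,c} = \dfrac{(k-1)\binom{m}{c}}{\binom{k-1}{c}}$.
   Context: An $(n, N, k, m)$-CBC (combinatorial batch code, with at most one item read per server) is a pair $(\mathcal{S}, \mathcal{X})$ where $\mathcal{S}$ is a set of $m$ elements (servers) and $\mathcal{X} = (X_1, \ldots, X_n)$ is a list (repetitions allowed) of $n$ subsets of $\mathcal{S}$ with $\sum_{j=1}^n |X_j| = N$, such that for every choice of $r$ distinct indices $i_1, \ldots, i_r \in \{1,\ldots,n\}$ with $1 \leq r \leq k$ one has $|X_{i_1} \cup \cdots \cup X_{i_r}| \geq r$ (equivalently, any $k$ of the sets have a system of distinct representatives). -}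

module Defs where

open import Data.Nat using (ℕ; zero; suc; _+_; _*_; _∸_; _≤_)
open import Data.Nat.Combinatorics using (_C_)
open import Data.Fin using (Fin)
open import Data.Fin.Subset using (Subset; ∣_∣; ⋃)
open import Data.Fin.Subset.Properties using (_∈?_)
open import Data.List using (List; map; filter; allFin; length)
open import Data.Nat.ListAction using (sum)
open import Data.Integer using (ℤ; +_)
open import Data.Rational using (ℚ; _/_; 0ℚ)
open import Relation.Nullary using (Dec)
open import Relation.Binary.PropositionalEquality using (_≡_)
open import Data.Product using (_×_)
open import Data.Nat using (_≟_)

-- A list of n subsets X_1..X_n of the server set S = Fin m.
Family : ℕ → ℕ → Set
Family n m = Fin n → Subset m

totalSize : ∀ {n m} → Family n m → ℕ
totalSize {n} X = sum (map (λ j → ∣ X j ∣) (allFin n))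

unionOver : ∀ {n m} → Family n m → Subset n → Subset m
unionOver {n} X I = ⋃ (map X (filter (λ i → i ∈? I) (allFin n)))

-- (n, N, k, m)-CBC: the family has N = Σ|X_j|, and any r distinct indices
-- (1 ≤ r ≤ k), i.e. any index set I with 1 ≤ |I| ≤ k, has |⋃_{i∈I} X_i| ≥ |I|.
IsCBC : (n N k m : ℕ) → Family n m → Set
IsCBC n N k m X =
  totalSize X ≡ N ×
  ((I : Subset n) → 1 ≤ ∣ I ∣ → ∣ I ∣ ≤ k → ∣ I ∣ ≤ ∣ unionOver X I ∣)

countOfSize : ∀ {n m} → ℕ → Family n m → ℕ
countOfSize {n} k X = length (filter (λ j → ∣ X j ∣ ≟ k) (allFin n))

-- U_{m,k,c} = (k-1) * C(m,c) / C(k-1,c)  as a rational.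
-- (When C(k-1,c) = 0, i.e. c > k-1, the value is irrelevant; we set it to 0.
--  Under the hypotheses 1 ≤ c ≤ k-1 this branch never occurs.)
U : ℕ → ℕ → ℕ → ℚ
U m k c with (k ∸ 1) C c
... | zero  = 0ℚ
... | suc d = (+ ((k ∸ 1) * (m C c))) / suc d

module Submission where

-- Write k = a + 1 and call a set T of a servers a block. At most a of the X_j fit inside a
-- block, since a + 1 of them inside T would have a union of size at most a; counting the
-- pairs X_j ⊆ T therefore gives  Σ_j #{blocks ⊇ X_j} ≤ a·C(m, a),  and a set of size s ≤ a
-- lies in C(m − s, a − s) blocks. Along t = a − s these numbers H(t) = C(m − a + t, t) form a
-- convex sequence, so H lies above its supporting line at t = a − c. Hence a fixed weight,
-- plus a bonus when |X_j| = k, is bounded for every X_j by a linear combination of |X_j| and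
-- its number of blocks. Summing over j and using C(m, a)·C(a, c) = C(m, c)·C(m − c, a − c)
-- gives the inequality with the denominators (m − k + 1)·C(k − 1, c) cleared.

open import Defs
open import Data.Nat using (ℕ; zero; suc; _+_; _*_; _∸_; _≤_; z≤n; s≤s; _≟_; _≤?_; NonZero; >-nonZero)
open import Data.Nat.Properties
open import Data.Nat.Combinatorics using (_C_; nCk+nC[k+1]≡[n+1]C[k+1])
open import Data.Nat.ListAction using (sum)
open import Data.Nat.ListAction.Properties using (sum-++)
open import Data.Nat.Tactic.RingSolver using (solve-∀)
open import Data.Integer as ℤ using (+_)
import Data.Integer.Properties as ℤ
open import Data.Integer.Properties using (pos-*)
open import Data.Integer.Tactic.RingSolver using () renaming (solve-∀ to ℤ-solve-∀)
import Data.Rational as ℚ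
open import Data.Rational using (ℚ; _/_; toℚᵘ) renaming (_≤_ to _≤ℚ_; _+_ to _+ℚ_; _-_ to _-ℚ_; _*_ to _*ℚ_)
import Data.Rational.Properties as ℚ
open import Data.Rational.Properties using (toℚᵘ-injective; toℚᵘ-fromℚᵘ; toℚᵘ-homo-+; toℚᵘ-homo-*; toℚᵘ-cancel-≤; normalize-pos)
open import Data.Rational.Solver using (module +-*-Solver)
open import Data.Rational.Unnormalised using (mkℚᵘ; *≡*; *≤*) renaming (_≃_ to _≃ᵘ_)
import Data.Rational.Unnormalised.Properties as ℚᵘ
open import Data.Bool using (true; false; if_then_else_)
open import Data.Product using (_,_; _×_; Σ-syntax)
open import Data.Sum using (inj₁; inj₂)
import Data.List as L
open import Data.List using (List; []; _∷_; _++_; map; filter; length; allFin)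
open import Data.List.Properties using (length-++; length-map; map-++; map-∘; map-tabulate; length-tabulate)
open import Data.List.Relation.Unary.All using (All; []; _∷_)
import Data.List.Relation.Unary.All as All
import Data.List.Relation.Unary.All.Properties as All
import Data.Vec as V
open import Data.Vec using ([]; _∷_)
open import Data.Vec.Properties using (lookup∘tabulate; []=⇒lookup)
open import Data.Fin using (Fin; zero; suc)
open import Data.Fin.Subset using (Subset; ∣_∣; inside; outside; _⊆_; _∈_; ⊥; ⋃)
open import Data.Fin.Subset.Properties using (_⊆?_; _∈?_; ∣p∣≤n; p⊆q⇒∣p∣≤∣q∣; ⊥⊆; ∉⊥; ∣⊥∣≡0; out⊆; in⊆in; x∈p∪q⁻)
open import Function using (_∘_)
open import Relation.Nullary using (Dec; does; yes; no; ¬_; contradiction)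
open import Relation.Nullary.Decidable using (dec-false)
open import Relation.Unary using (Pred; Decidable)
open import Relation.Binary.PropositionalEquality using (_≡_; refl; sym; trans; cong; cong₂; subst; subst₂; module ≡-Reasoning)
import Algebra.Properties.CommutativeSemigroup as CommSemigroupProperties

private
  module +-Props = CommSemigroupProperties +-commutativeSemigroup
  module *-Props = CommSemigroupProperties *-commutativeSemigroup

iverson : ∀ {p} {P : Set p} → Dec P → ℕ
iverson d = if does d then 1 else 0

iverson≤1 : ∀ {p} {P : Set p} (d : Dec P) → iverson d ≤ 1
iverson≤1 d with does d
... | true  = ≤-refl
... | false = z≤n

iverson-no : ∀ {p} {P : Set p} (d : Dec P) → ¬ P → iverson d ≡ 0
iverson-no d ¬p = cong (λ b → if b then 1 else 0) (dec-false d ¬p)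

module _ {A : Set} where

  sum-map-+ : ∀ (f g : A → ℕ) xs →
              sum (map (λ x → f x + g x) xs) ≡ sum (map f xs) + sum (map g xs)
  sum-map-+ f g [] = refl
  sum-map-+ f g (x ∷ xs) rewrite sum-map-+ f g xs = +-+-exchange (f x) (g x) _ _
    where
    +-+-exchange : ∀ a b c d → a + b + (c + d) ≡ a + c + (b + d)
    +-+-exchange = solve-∀

  sum-map-*ˡ : ∀ a (f : A → ℕ) xs → sum (map (λ x → a * f x) xs) ≡ a * sum (map f xs)
  sum-map-*ˡ a f [] = sym (*-zeroʳ a)
  sum-map-*ˡ a f (x ∷ xs) rewrite sum-map-*ˡ a f xs = sym (*-distribˡ-+ a (f x) _)

  sum-map-const : ∀ a (xs : List A) → sum (map (λ _ → a) xs) ≡ length xs * a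
  sum-map-const a [] = refl
  sum-map-const a (x ∷ xs) = cong (λ s → a + s) (sum-map-const a xs)

  sum-map-mono : ∀ {f g : A → ℕ} → (∀ x → f x ≤ g x) → ∀ xs → sum (map f xs) ≤ sum (map g xs)
  sum-map-mono f≤g [] = z≤n
  sum-map-mono f≤g (x ∷ xs) = +-mono-≤ (f≤g x) (sum-map-mono f≤g xs)

  sum-map-≤-length* : ∀ {f : A → ℕ} {b xs} → All (λ x → f x ≤ b) xs → sum (map f xs) ≤ length xs * b
  sum-map-≤-length* [] = z≤n
  sum-map-≤-length* (fx≤b ∷ fxs≤b) = +-mono-≤ fx≤b (sum-map-≤-length* fxs≤b)

  sum-map-iverson : ∀ {p} {P : Pred A p} (P? : Decidable P) xs →
                    sum (map (λ x → iverson (P? x)) xs) ≡ length (filter P? xs)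
  sum-map-iverson P? [] = refl
  sum-map-iverson P? (x ∷ xs) with does (P? x)
  ... | true  = cong suc (sum-map-iverson P? xs)
  ... | false = sum-map-iverson P? xs

module _ {A B : Set} where

  sum-map-map : ∀ (f : B → ℕ) (g : A → B) xs → sum (map f (map g xs)) ≡ sum (map (λ x → f (g x)) xs)
  sum-map-map f g xs = cong sum (sym (map-∘ xs))

  sum-map-swap : ∀ (f : A → B → ℕ) xs ys →
                 sum (map (λ x → sum (map (f x) ys)) xs) ≡ sum (map (λ y → sum (map (λ x → f x y) xs)) ys)
  sum-map-swap f [] ys = sym (trans (sum-map-const 0 ys) (*-zeroʳ (length ys)))
  sum-map-swap f (x ∷ xs) ys rewrite sum-map-swap f xs ys =
    sym (sum-map-+ (f x) (λ y → sum (map (λ x → f x y) xs)) ys)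

-- The library's n C k goes through factorials; Pascal's recursion computes by pattern matching.
binom : ℕ → ℕ → ℕ
binom n       zero    = 1
binom zero    (suc k) = 0
binom (suc n) (suc k) = binom n k + binom n (suc k)

C≡binom : ∀ n k → n C k ≡ binom n k
C≡binom n       zero    = refl
C≡binom zero    (suc k) = refl
C≡binom (suc n) (suc k) =
  trans (sym (nCk+nC[k+1]≡[n+1]C[k+1] n k)) (cong₂ _+_ (C≡binom n k) (C≡binom n (suc k)))

binom-pos : ∀ {n k} → k ≤ n → 1 ≤ binom n k
binom-pos {n}     {zero}  _         = s≤s z≤n
binom-pos {suc n} {suc k} (s≤s k≤n) = ≤-trans (binom-pos k≤n) (m≤m+n _ _)

binom-absorb : ∀ n k → binom (suc n) (suc k) * suc k ≡ suc n * binom n k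
binom-absorb n       zero    = cong (_* 1) (binom1 (suc n))
  where
  binom1 : ∀ n → binom n 1 ≡ n
  binom1 zero    = refl
  binom1 (suc n) = cong suc (binom1 n)
binom-absorb zero    (suc k) = refl
binom-absorb (suc n) (suc k) = begin
  (x + y) * suc (suc k)                                  ≡⟨ distrib x y k ⟩
  x * suc k + y * suc (suc k) + x                        ≡⟨ cong₂ (λ p q → p + q + x) (binom-absorb n k) (binom-absorb n (suc k)) ⟩
  suc n * binom n k + suc n * binom n (suc k) + x        ≡⟨ collect n (binom n k) (binom n (suc k)) ⟩
  suc (suc n) * (binom n k + binom n (suc k))            ∎
  where
  open ≡-Reasoning
  x = binom (suc n) (suc k)
  y = binom (suc n) (suc (suc k))
  distrib : ∀ x y k → (x + y) * suc (suc k) ≡ x * suc k + y * suc (suc k) + x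
  distrib = solve-∀
  collect : ∀ n a b → suc n * a + suc n * b + (a + b) ≡ suc (suc n) * (a + b)
  collect = solve-∀

binom-subset-of-subset : ∀ n a c → c ≤ a → binom n a * binom a c ≡ binom n c * binom (n ∸ c) (a ∸ c)
binom-subset-of-subset n       a       zero    _         = trans (*-identityʳ _) (sym (+-identityʳ _))
binom-subset-of-subset zero    (suc a) (suc c) _         = refl
binom-subset-of-subset (suc n) (suc a) (suc c) (s≤s c≤a) = *-cancelʳ-≡ _ _ (suc c) (begin
  binom (suc n) (suc a) * binom (suc a) (suc c) * suc c     ≡⟨ *-assoc (binom (suc n) (suc a)) _ _ ⟩
  binom (suc n) (suc a) * (binom (suc a) (suc c) * suc c)   ≡⟨ cong (binom (suc n) (suc a) *_) (binom-absorb a c) ⟩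
  binom (suc n) (suc a) * (suc a * binom a c)               ≡⟨ *-assoc (binom (suc n) (suc a)) _ _ ⟨
  binom (suc n) (suc a) * suc a * binom a c                 ≡⟨ cong (_* binom a c) (binom-absorb n a) ⟩
  suc n * binom n a * binom a c                             ≡⟨ *-assoc (suc n) (binom n a) (binom a c) ⟩
  suc n * (binom n a * binom a c)                           ≡⟨ cong (suc n *_) (binom-subset-of-subset n a c c≤a) ⟩
  suc n * (binom n c * binom (n ∸ c) (a ∸ c))               ≡⟨ *-assoc (suc n) (binom n c) (binom (n ∸ c) (a ∸ c)) ⟨
  suc n * binom n c * binom (n ∸ c) (a ∸ c)                 ≡⟨ cong (_* binom (n ∸ c) (a ∸ c)) (binom-absorb n c) ⟨
  binom (suc n) (suc c) * suc c * binom (n ∸ c) (a ∸ c)     ≡⟨ *-Props.xy∙z≈xz∙y (binom (suc n) (suc c)) _ _ ⟩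
  binom (suc n) (suc c) * binom (n ∸ c) (a ∸ c) * suc c     ∎)
  where open ≡-Reasoning

module _ {f g : ℕ → ℕ} (f-suc : ∀ t → f (suc t) ≡ f t + g t) (g-suc : ∀ t → g t ≤ g (suc t)) where

  private
    g-mono : ∀ t d → g t ≤ g (d + t)
    g-mono t zero    = ≤-refl
    g-mono t (suc d) = ≤-trans (g-mono t d) (g-suc (d + t))

  above-tangent : ∀ u d → f u + d * g u ≤ f (d + u)
  above-tangent u zero    = ≤-reflexive (+-identityʳ (f u))
  above-tangent u (suc d) = begin
    f u + (g u + d * g u)   ≡⟨ +-Props.x∙yz≈xz∙y (f u) (g u) (d * g u) ⟩
    f u + d * g u + g u     ≤⟨ +-mono-≤ (above-tangent u d) (g-mono u d) ⟩
    f (d + u) + g (d + u)   ≡⟨ f-suc (d + u) ⟨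
    f (suc d + u)           ∎
    where open ≤-Reasoning

  below-tangent : ∀ t d → f (d + t) ≤ f t + d * g (d + t)
  below-tangent t zero    = ≤-reflexive (sym (+-identityʳ (f t)))
  below-tangent t (suc d) = begin
    f (suc d + t)                        ≡⟨ f-suc (d + t) ⟩
    f (d + t) + g (d + t)                ≤⟨ +-monoˡ-≤ _ (below-tangent t d) ⟩
    f t + d * g (d + t) + g (d + t)      ≤⟨ +-mono-≤ (+-monoʳ-≤ (f t) (*-monoʳ-≤ d (g-suc (d + t)))) (g-suc (d + t)) ⟩
    f t + d * g u + g u                  ≡⟨ +-Props.x∙yz≈xz∙y (f t) (g u) (d * g u) ⟨
    f t + (g u + d * g u)                ∎
    where
    open ≤-Reasoning
    u = suc d + t

  -- f t ≥ f u + (t − u) · g u, with t − u written as c − s to avoid subtraction.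
  supporting-line : ∀ {c s t u} → s + t ≡ c + u → f u + g u * c ≤ f t + g u * s
  supporting-line {c} {s} {t} {u} s+t≡c+u with ≤-total u t
  ... | inj₁ u≤t with d , refl ← m≤n⇒∃[o]m+o≡n u≤t = begin
    f u + g u * c             ≡⟨ cong (λ x → f u + g u * x) c≡s+d ⟩
    f u + g u * (s + d)       ≡⟨ shuffle (f u) (g u) s d ⟩
    f u + d * g u + g u * s   ≤⟨ +-monoˡ-≤ (g u * s) (above-tangent u d) ⟩
    f (d + u) + g u * s       ≡⟨ cong (λ x → f x + g u * s) (+-comm d u) ⟩
    f (u + d) + g u * s       ∎
    where
    open ≤-Reasoning
    c≡s+d : c ≡ s + d
    c≡s+d = +-cancelʳ-≡ u c (s + d) (trans (sym s+t≡c+u) (+-Props.x∙yz≈xz∙y s u d))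
    shuffle : ∀ x y s d → x + y * (s + d) ≡ x + d * y + y * s
    shuffle = solve-∀
  ... | inj₂ t≤u with d , refl ← m≤n⇒∃[o]m+o≡n t≤u = begin
    f (t + d) + g u * c       ≡⟨ cong (λ x → f x + g u * c) (+-comm t d) ⟩
    f (d + t) + g u * c       ≤⟨ +-monoˡ-≤ (g u * c) (below-tangent t d) ⟩
    f t + d * g (d + t) + g u * c  ≡⟨ cong (λ x → f t + d * g x + g u * c) (+-comm d t) ⟩
    f t + d * g u + g u * c   ≡⟨ shuffle (f t) (g u) c d ⟩
    f t + g u * (c + d)       ≡⟨ cong (λ x → f t + g u * x) s≡c+d ⟨
    f t + g u * s             ∎
    where
    open ≤-Reasoning
    s≡c+d : s ≡ c + d
    s≡c+d = +-cancelʳ-≡ t s (c + d) (trans s+t≡c+u (+-Props.x∙yz≈xz∙y c t d))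
    shuffle : ∀ x y c d → x + d * y + y * c ≡ x + y * (c + d)
    shuffle = solve-∀

module _ (M : ℕ) where

  binom-diag-suc : ∀ t → binom (M + suc t) (suc t) ≡ binom (M + t) t + binom (M + t) (suc t)
  binom-diag-suc t rewrite +-suc M t = refl

  binom-diag-step-mono : ∀ t → binom (M + t) (suc t) ≤ binom (M + suc t) (suc (suc t))
  binom-diag-step-mono t rewrite +-suc M t = m≤m+n _ _

  binom-diag-absorb : ∀ t → suc t * binom (M + t) (suc t) ≡ M * binom (M + t) t
  binom-diag-absorb t = +-cancelʳ-≡ (suc t * H) _ _ (begin
    suc t * K + suc t * H     ≡⟨ rearrange H K t ⟩
    (H + K) * suc t           ≡⟨ binom-absorb (M + t) t ⟩
    suc (M + t) * H           ≡⟨ distrib M t H ⟩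
    M * H + suc t * H         ∎)
    where
    open ≡-Reasoning
    H = binom (M + t) t
    K = binom (M + t) (suc t)
    rearrange : ∀ h k t → suc t * k + suc t * h ≡ (h + k) * suc t
    rearrange = solve-∀
    distrib : ∀ m t h → suc (m + t) * h ≡ m * h + suc t * h
    distrib = solve-∀

  binom-diag-supporting-line : ∀ {c s t u} → s + t ≡ c + u →
    let D = binom (M + u) u in M * D * c + suc u * D ≤ M * D * s + suc u * binom (M + t) t
  binom-diag-supporting-line {c} {s} {t} {u} s+t≡c+u = begin
    M * D * c + suc u * D             ≡⟨ cong (λ x → x * c + suc u * D) (binom-diag-absorb u) ⟨
    suc u * K * c + suc u * D         ≡⟨ factor (suc u) K D c ⟩
    suc u * (D + K * c)               ≤⟨ *-monoʳ-≤ (suc u) (supporting-line binom-diag-suc binom-diag-step-mono s+t≡c+u) ⟩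
    suc u * (binom (M + t) t + K * s) ≡⟨ factor (suc u) K (binom (M + t) t) s ⟨
    suc u * K * s + suc u * binom (M + t) t ≡⟨ cong (λ x → x * s + suc u * binom (M + t) t) (binom-diag-absorb u) ⟩
    M * D * s + suc u * binom (M + t) t ∎
    where
    open ≤-Reasoning
    D = binom (M + u) u
    K = binom (M + u) (suc u)
    factor : ∀ a k d c → a * k * c + a * d ≡ a * (d + k * c)
    factor = solve-∀

subsetsOfSize : (m a : ℕ) → List (Subset m)
subsetsOfSize zero    zero    = [] ∷ []
subsetsOfSize zero    (suc a) = []
subsetsOfSize (suc m) zero    = map (outside ∷_) (subsetsOfSize m zero)
subsetsOfSize (suc m) (suc a) = map (outside ∷_) (subsetsOfSize m (suc a)) ++ map (inside ∷_) (subsetsOfSize m a)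

subsetsOfSize-size : ∀ m a → All (λ T → ∣ T ∣ ≡ a) (subsetsOfSize m a)
subsetsOfSize-size zero    zero    = refl ∷ []
subsetsOfSize-size zero    (suc a) = []
subsetsOfSize-size (suc m) zero    = All.map⁺ (subsetsOfSize-size m zero)
subsetsOfSize-size (suc m) (suc a) =
  All.++⁺ (All.map⁺ (subsetsOfSize-size m (suc a))) (All.map⁺ (All.map (cong suc) (subsetsOfSize-size m a)))

length-subsetsOfSize : ∀ m a → length (subsetsOfSize m a) ≡ binom m a
length-subsetsOfSize zero    zero    = refl
length-subsetsOfSize zero    (suc a) = refl
length-subsetsOfSize (suc m) zero    = trans (length-map _ (subsetsOfSize m zero)) (length-subsetsOfSize m zero)
length-subsetsOfSize (suc m) (suc a) = begin
  length (map (outside ∷_) (subsetsOfSize m (suc a)) ++ map (inside ∷_) (subsetsOfSize m a))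
    ≡⟨ length-++ (map (outside ∷_) (subsetsOfSize m (suc a))) ⟩
  length (map (outside ∷_) (subsetsOfSize m (suc a))) + length (map (inside ∷_) (subsetsOfSize m a))
    ≡⟨ cong₂ _+_ (length-map _ (subsetsOfSize m (suc a))) (length-map _ (subsetsOfSize m a)) ⟩
  length (subsetsOfSize m (suc a)) + length (subsetsOfSize m a)
    ≡⟨ cong₂ _+_ (length-subsetsOfSize m (suc a)) (length-subsetsOfSize m a) ⟩
  binom m (suc a) + binom m a
    ≡⟨ +-comm (binom m (suc a)) (binom m a) ⟩
  binom (suc m) (suc a) ∎
  where open ≡-Reasoning

sum-subsetsOfSize-suc : ∀ m a (f : Subset (suc m) → ℕ) →
  sum (map f (subsetsOfSize (suc m) (suc a))) ≡
  sum (map (λ T → f (outside ∷ T)) (subsetsOfSize m (suc a))) + sum (map (λ T → f (inside ∷ T)) (subsetsOfSize m a))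
sum-subsetsOfSize-suc m a f = begin
  sum (map f (map (outside ∷_) S₁ ++ map (inside ∷_) S₀))
    ≡⟨ cong sum (map-++ f (map (outside ∷_) S₁) _) ⟩
  sum (map f (map (outside ∷_) S₁) ++ map f (map (inside ∷_) S₀))
    ≡⟨ sum-++ (map f (map (outside ∷_) S₁)) _ ⟩
  sum (map f (map (outside ∷_) S₁)) + sum (map f (map (inside ∷_) S₀))
    ≡⟨ cong₂ _+_ (sum-map-map f (outside ∷_) S₁) (sum-map-map f (inside ∷_) S₀) ⟩
  sum (map (λ T → f (outside ∷ T)) S₁) + sum (map (λ T → f (inside ∷ T)) S₀) ∎
  where
  open ≡-Reasoning
  S₁ = subsetsOfSize m (suc a)
  S₀ = subsetsOfSize m a

nSupersets : ∀ {m} → ℕ → Subset m → ℕ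
nSupersets {m} a Y = sum (map (λ T → iverson (Y ⊆? T)) (subsetsOfSize m a))

nSupersets-outside : ∀ {m} a (Y : Subset m) → nSupersets a Y ≤ nSupersets a (outside ∷ Y)
nSupersets-outside {m} zero    Y = ≤-reflexive (sym (sum-map-map (λ T → iverson (outside ∷ Y ⊆? T)) (outside ∷_) (subsetsOfSize m zero)))
nSupersets-outside {m} (suc a) Y = ≤-trans (m≤m+n _ _) (≤-reflexive (sym (sum-subsetsOfSize-suc m a (λ T → iverson (outside ∷ Y ⊆? T)))))

nSupersets-lower : ∀ {m} (Y : Subset m) t → binom (m ∸ ∣ Y ∣) t ≤ nSupersets (∣ Y ∣ + t) Y
nSupersets-lower []            zero    = s≤s z≤n
nSupersets-lower []            (suc t) = z≤n
nSupersets-lower {suc m} (outside ∷ Y) t rewrite +-∸-assoc 1 (∣p∣≤n Y) with t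
... | zero    = ≤-trans (nSupersets-lower Y zero) (nSupersets-outside (∣ Y ∣ + zero) Y)
... | suc t   = begin
  binom (m ∸ ∣ Y ∣) t + binom (m ∸ ∣ Y ∣) (suc t)
    ≤⟨ +-mono-≤ (nSupersets-lower Y t) (subst (λ a → binom (m ∸ ∣ Y ∣) (suc t) ≤ nSupersets a Y) (+-suc ∣ Y ∣ t) (nSupersets-lower Y (suc t))) ⟩
  nSupersets (∣ Y ∣ + t) Y + nSupersets (suc (∣ Y ∣ + t)) Y
    ≡⟨ +-comm (nSupersets (∣ Y ∣ + t) Y) _ ⟩
  nSupersets (suc (∣ Y ∣ + t)) Y + nSupersets (∣ Y ∣ + t) Y
    ≡⟨ sum-subsetsOfSize-suc m (∣ Y ∣ + t) (λ T → iverson (outside ∷ Y ⊆? T)) ⟨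
  nSupersets (suc (∣ Y ∣ + t)) (outside ∷ Y)
    ≡⟨ cong (λ a → nSupersets a (outside ∷ Y)) (+-suc ∣ Y ∣ t) ⟨
  nSupersets (∣ Y ∣ + suc t) (outside ∷ Y) ∎
  where open ≤-Reasoning
nSupersets-lower {suc m} (inside ∷ Y) t =
  ≤-trans (nSupersets-lower Y t)
    (≤-trans (m≤n+m _ _) (≤-reflexive (sym (sum-subsetsOfSize-suc m (∣ Y ∣ + t) (λ T → iverson (inside ∷ Y ⊆? T))))))

∈-tabulate-does : ∀ {n p} {P : Pred (Fin n) p} (P? : Decidable P) {i} →
                  i ∈ V.tabulate (λ j → does (P? j)) → P i
∈-tabulate-does {P = P} P? {i} i∈ =
  witness (P? i) (trans (sym (lookup∘tabulate (λ j → does (P? j)) i)) ([]=⇒lookup i∈))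
  where
  witness : (d : Dec (P i)) → does d ≡ true → P i
  witness (yes p) _ = p

∣tabulate-does∣ : ∀ {n p} {P : Pred (Fin n) p} (P? : Decidable P) →
                  ∣ V.tabulate (λ i → does (P? i)) ∣ ≡ sum (map (λ i → iverson (P? i)) (allFin n))
∣tabulate-does∣ {n} P? = trans (count-tabulate P?) (cong sum (sym (map-tabulate (λ i → i) (λ i → iverson (P? i)))))
  where
  count-tabulate : ∀ {n} {P : Pred (Fin n) _} (P? : Decidable P) →
                   ∣ V.tabulate (λ i → does (P? i)) ∣ ≡ sum (L.tabulate (λ i → iverson (P? i)))
  count-tabulate {zero}  P? = refl
  count-tabulate {suc n} P? with does (P? zero)
  ... | true  = cong suc (count-tabulate (P? ∘ suc))
  ... | false = count-tabulate (P? ∘ suc)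

subset-of-size : ∀ {n} (J : Subset n) r → r ≤ ∣ J ∣ → Σ[ I ∈ Subset n ] I ⊆ J × ∣ I ∣ ≡ r
subset-of-size {n} J       zero    _         = ⊥ , ⊥⊆ , ∣⊥∣≡0 n
subset-of-size (outside ∷ J) (suc r) r≤∣J∣   with I , I⊆J , ∣I∣≡r ← subset-of-size J (suc r) r≤∣J∣ =
  outside ∷ I , out⊆ I⊆J , ∣I∣≡r
subset-of-size (inside ∷ J) (suc r) (s≤s r≤∣J∣) with I , I⊆J , ∣I∣≡r ← subset-of-size J r r≤∣J∣ =
  inside ∷ I , in⊆in I⊆J , cong suc ∣I∣≡r

⋃⊆ : ∀ {m} {Ys : List (Subset m)} {T} → All (_⊆ T) Ys → ⋃ Ys ⊆ T
⋃⊆ []                        x∈     = contradiction x∈ ∉⊥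
⋃⊆ {Ys = Y ∷ Ys} (Y⊆T ∷ Ys⊆T) x∈ with x∈p∪q⁻ Y (⋃ Ys) x∈
... | inj₁ x∈Y  = Y⊆T x∈Y
... | inj₂ x∈Ys = ⋃⊆ Ys⊆T x∈Ys

unionOver⊆ : ∀ {n m} (X : Family n m) (I : Subset n) {T} → (∀ {i} → i ∈ I → X i ⊆ T) → unionOver X I ⊆ T
unionOver⊆ {n} X I X⊆T = ⋃⊆ (All.map⁺ (All.map X⊆T (All.all-filter (_∈? I) (allFin n))))

module _ {n m} (a : ℕ) (X : Family n m)
         (union-large : (I : Subset n) → ∣ I ∣ ≡ suc a → suc a ≤ ∣ unionOver X I ∣) where

  sets-inside-≤ : ∀ T → ∣ T ∣ ≡ a → sum (map (λ j → iverson (X j ⊆? T)) (allFin n)) ≤ a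
  sets-inside-≤ T ∣T∣≡a = ≮⇒≥ λ a<count →
    let I , I⊆J , ∣I∣≡1+a = subset-of-size J (suc a) (≤-trans a<count (≤-reflexive (sym (∣tabulate-does∣ (λ j → X j ⊆? T)))))
    in n≮n a (begin-strict
      a                        <⟨ n<1+n a ⟩
      suc a                    ≤⟨ union-large I ∣I∣≡1+a ⟩
      ∣ unionOver X I ∣        ≤⟨ p⊆q⇒∣p∣≤∣q∣ (unionOver⊆ X I (λ i∈I → ∈-tabulate-does (λ j → X j ⊆? T) (I⊆J i∈I))) ⟩
      ∣ T ∣                    ≡⟨ ∣T∣≡a ⟩
      a                        ∎)
    where
    open ≤-Reasoning
    J = V.tabulate (λ j → does (X j ⊆? T))

  sum-nSupersets-≤ : sum (map (λ j → nSupersets a (X j)) (allFin n)) ≤ a * binom m a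
  sum-nSupersets-≤ = begin
    sum (map (λ j → sum (map (λ T → iverson (X j ⊆? T)) (subsetsOfSize m a))) (allFin n))
      ≡⟨ sum-map-swap (λ j T → iverson (X j ⊆? T)) (allFin n) (subsetsOfSize m a) ⟩
    sum (map (λ T → sum (map (λ j → iverson (X j ⊆? T)) (allFin n))) (subsetsOfSize m a))
      ≤⟨ sum-map-≤-length* (All.map (sets-inside-≤ _) (subsetsOfSize-size m a)) ⟩
    length (subsetsOfSize m a) * a
      ≡⟨ cong (_* a) (length-subsetsOfSize m a) ⟩
    binom m a * a
      ≡⟨ *-comm (binom m a) a ⟩
    a * binom m a ∎
    where open ≤-Reasoning

private
  weight-at-k : ∀ e c u D → suc e * D * c + suc u * D + suc u * e * D * 1 ≡ suc e * D * suc (c + u)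
  weight-at-k = solve-∀

  suc[s+t]+e∸s≡suc[e]+t : ∀ s t e → suc (s + t) + e ∸ s ≡ suc e + t
  suc[s+t]+e∸s≡suc[e]+t s t e = trans (cong (_∸ s) (regroup s t e)) (m+n∸m≡n s (suc e + t))
    where
    regroup : ∀ s t e → suc (s + t) + e ≡ s + (suc e + t)
    regroup = solve-∀

set-weight-bound : ∀ e c u (Y : Subset (suc (c + u) + e)) →
  let M = suc e ; D = binom (M + u) u in
  M * D * c + suc u * D + suc u * e * D * iverson (∣ Y ∣ ≟ suc (c + u)) ≤ M * D * ∣ Y ∣ + suc u * nSupersets (c + u) Y
set-weight-bound e c u Y with ∣ Y ∣ ≤? c + u
... | yes ∣Y∣≤a with t , s+t≡a ← m≤n⇒∃[o]m+o≡n ∣Y∣≤a = begin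
  M * D * c + suc u * D + suc u * e * D * iverson (∣ Y ∣ ≟ suc (c + u))
    ≡⟨ cong (λ i → M * D * c + suc u * D + suc u * e * D * i) (iverson-no (∣ Y ∣ ≟ suc (c + u)) (<⇒≢ (s≤s ∣Y∣≤a))) ⟩
  M * D * c + suc u * D + suc u * e * D * 0
    ≡⟨ cong (λ x → M * D * c + suc u * D + x) (*-zeroʳ (suc u * e * D)) ⟩
  M * D * c + suc u * D + 0
    ≡⟨ +-identityʳ _ ⟩
  M * D * c + suc u * D
    ≤⟨ binom-diag-supporting-line M {c} {∣ Y ∣} {t} {u} s+t≡a ⟩
  M * D * ∣ Y ∣ + suc u * binom (M + t) t
    ≤⟨ +-monoʳ-≤ (M * D * ∣ Y ∣) (*-monoʳ-≤ (suc u) supersets) ⟩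
  M * D * ∣ Y ∣ + suc u * nSupersets (c + u) Y ∎
  where
  open ≤-Reasoning
  M = suc e
  D = binom (M + u) u
  supersets : binom (M + t) t ≤ nSupersets (c + u) Y
  supersets = subst₂ (λ r a → binom r t ≤ nSupersets a Y) m∸s≡M+t s+t≡a (nSupersets-lower Y t)
    where
    m∸s≡M+t : suc (c + u) + e ∸ ∣ Y ∣ ≡ M + t
    m∸s≡M+t = trans (cong (λ a → suc a + e ∸ ∣ Y ∣) (sym s+t≡a)) (suc[s+t]+e∸s≡suc[e]+t ∣ Y ∣ t e)
... | no ∣Y∣≰a = begin
  M * D * c + suc u * D + suc u * e * D * iverson (∣ Y ∣ ≟ suc (c + u))
    ≤⟨ +-monoʳ-≤ (M * D * c + suc u * D) (*-monoʳ-≤ (suc u * e * D) (iverson≤1 (∣ Y ∣ ≟ suc (c + u)))) ⟩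
  M * D * c + suc u * D + suc u * e * D * 1
    ≡⟨ weight-at-k e c u D ⟩
  M * D * suc (c + u)
    ≤⟨ *-monoʳ-≤ (M * D) (≰⇒> ∣Y∣≰a) ⟩
  M * D * ∣ Y ∣
    ≤⟨ m≤m+n _ _ ⟩
  M * D * ∣ Y ∣ + suc u * nSupersets (c + u) Y ∎
  where
  open ≤-Reasoning
  M = suc e
  D = binom (M + u) u

cbc-weighted-count : ∀ {n} e c u (X : Family n (suc (c + u) + e)) →
  ((I : Subset n) → ∣ I ∣ ≡ suc (c + u) → suc (c + u) ≤ ∣ unionOver X I ∣) →
  let M = suc e ; D = binom (M + u) u in
  n * (M * D * c + suc u * D) + suc u * e * D * countOfSize (suc (c + u)) X
    ≤ M * D * totalSize X + suc u * ((c + u) * binom (suc (c + u) + e) (c + u))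
cbc-weighted-count {n} e c u X union-large = begin
  n * base + extra * countOfSize k X
    ≡⟨ cong₂ _+_ (cong (_* base) (length-allFin n)) (cong (extra *_) (sum-map-iverson (λ j → ∣ X j ∣ ≟ k) (allFin n))) ⟨
  length (allFin n) * base + extra * sum (map (λ j → iverson (∣ X j ∣ ≟ k)) (allFin n))
    ≡⟨ cong₂ _+_ (sum-map-const base (allFin n)) (sum-map-*ˡ extra (λ j → iverson (∣ X j ∣ ≟ k)) (allFin n)) ⟨
  sum (map (λ _ → base) (allFin n)) + sum (map (λ j → extra * iverson (∣ X j ∣ ≟ k)) (allFin n))
    ≡⟨ sum-map-+ (λ _ → base) (λ j → extra * iverson (∣ X j ∣ ≟ k)) (allFin n) ⟨
  sum (map (λ j → base + extra * iverson (∣ X j ∣ ≟ k)) (allFin n))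
    ≤⟨ sum-map-mono (λ j → set-weight-bound e c u (X j)) (allFin n) ⟩
  sum (map (λ j → M * D * ∣ X j ∣ + suc u * nSupersets a (X j)) (allFin n))
    ≡⟨ sum-map-+ (λ j → M * D * ∣ X j ∣) (λ j → suc u * nSupersets a (X j)) (allFin n) ⟩
  sum (map (λ j → M * D * ∣ X j ∣) (allFin n)) + sum (map (λ j → suc u * nSupersets a (X j)) (allFin n))
    ≡⟨ cong₂ _+_ (sum-map-*ˡ (M * D) (λ j → ∣ X j ∣) (allFin n)) (sum-map-*ˡ (suc u) (λ j → nSupersets a (X j)) (allFin n)) ⟩
  M * D * totalSize X + suc u * sum (map (λ j → nSupersets a (X j)) (allFin n))
    ≤⟨ +-monoʳ-≤ (M * D * totalSize X) (*-monoʳ-≤ (suc u) (sum-nSupersets-≤ a X union-large)) ⟩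
  M * D * totalSize X + suc u * (a * binom (k + e) a) ∎
  where
  open ≤-Reasoning
  a = c + u
  k = suc a
  M = suc e
  D = binom (M + u) u
  base = M * D * c + suc u * D
  extra = suc u * e * D
  length-allFin : ∀ n → length (allFin n) ≡ n
  length-allFin n = length-tabulate (λ i → i)

cbc-bound-binom : ∀ {n} e c u (X : Family n (suc (c + u) + e)) →
  ((I : Subset n) → ∣ I ∣ ≡ suc (c + u) → suc (c + u) ≤ ∣ unionOver X I ∣) →
  let Q = binom (c + u) c in
  suc e * Q * (n * c) + suc u * n * Q + suc u * e * countOfSize (suc (c + u)) X * Q
    ≤ suc e * Q * totalSize X + suc u * ((c + u) * binom (suc (c + u) + e) c)
cbc-bound-binom {n} e c u X union-large = *-cancelˡ-≤ D {{D≢0}} (begin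
  D * (M * Q * (n * c) + suc u * n * Q + suc u * e * A * Q)
    ≡⟨ factor-lhs D M Q n c u e A ⟩
  (n * (M * D * c + suc u * D) + suc u * e * D * A) * Q
    ≤⟨ *-monoˡ-≤ Q (cbc-weighted-count e c u X union-large) ⟩
  (M * D * N + suc u * (a * binom m a)) * Q
    ≡⟨ factor-rhs D M Q N u a (binom m a) ⟩
  D * (M * Q * N) + suc u * a * (binom m a * Q)
    ≡⟨ cong (λ x → D * (M * Q * N) + suc u * a * x) binom-m-a*Q ⟩
  D * (M * Q * N) + suc u * a * (binom m c * D)
    ≡⟨ collect D M Q N u a (binom m c) ⟩
  D * (M * Q * N + suc u * (a * binom m c)) ∎)
  where
  open ≤-Reasoning
  a = c + u
  m = suc a + e
  M = suc e
  D = binom (M + u) u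
  Q = binom a c
  N = totalSize X
  A = countOfSize (suc a) X
  D≢0 : NonZero D
  D≢0 = >-nonZero (binom-pos (m≤n+m u M))
  binom-m-a*Q : binom m a * Q ≡ binom m c * D
  binom-m-a*Q = trans (binom-subset-of-subset m a c (m≤m+n c u))
    (cong₂ (λ x y → binom m c * binom x y) (trans (cong (_∸ c) (regroup c u e)) (m+n∸m≡n c (M + u))) (m+n∸m≡n c u))
    where
    regroup : ∀ c u e → suc (c + u) + e ≡ c + (suc e + u)
    regroup = solve-∀
  factor-lhs : ∀ D M Q n c u e A → D * (M * Q * (n * c) + suc u * n * Q + suc u * e * A * Q)
                                 ≡ (n * (M * D * c + suc u * D) + suc u * e * D * A) * Q
  factor-lhs = solve-∀
  factor-rhs : ∀ D M Q N u a x → (M * D * N + suc u * (a * x)) * Q ≡ D * (M * Q * N) + suc u * a * (x * Q)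
  factor-rhs = solve-∀
  collect : ∀ D M Q N u a y → D * (M * Q * N) + suc u * a * (y * D) ≡ D * (M * Q * N + suc u * (a * y))
  collect = solve-∀

ι : ℕ → ℚ
ι x = (+ x) / 1

private
  toℚᵘ-/suc : ∀ x d → toℚᵘ ((+ x) / suc d) ≃ᵘ mkℚᵘ (+ x) d
  toℚᵘ-/suc x d = toℚᵘ-fromℚᵘ (mkℚᵘ (+ x) d)

ι-+ : ∀ x y → ι (x + y) ≡ ι x +ℚ ι y
ι-+ x y = toℚᵘ-injective (ℚᵘ.≃-trans (toℚᵘ-/suc (x + y) 0) (ℚᵘ.≃-trans (*≡* (distrib (+ x) (+ y)))
  (ℚᵘ.≃-sym (ℚᵘ.≃-trans (toℚᵘ-homo-+ (ι x) (ι y)) (ℚᵘ.+-cong (toℚᵘ-/suc x 0) (toℚᵘ-/suc y 0))))))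
  where
  distrib : ∀ x y → (x ℤ.+ y) ℤ.* + 1 ≡ (x ℤ.* + 1 ℤ.+ y ℤ.* + 1) ℤ.* + 1
  distrib = ℤ-solve-∀

ι-* : ∀ x y → ι (x * y) ≡ ι x *ℚ ι y
ι-* x y = toℚᵘ-injective (ℚᵘ.≃-trans (toℚᵘ-/suc (x * y) 0) (ℚᵘ.≃-trans (*≡* (cong (ℤ._* + 1) (pos-* x y)))
  (ℚᵘ.≃-sym (ℚᵘ.≃-trans (toℚᵘ-homo-* (ι x) (ι y)) (ℚᵘ.*-cong (toℚᵘ-/suc x 0) (toℚᵘ-/suc y 0))))))

ι-mono : ∀ {x y} → x ≤ y → ι x ≤ℚ ι y
ι-mono {x} {y} x≤y = toℚᵘ-cancel-≤ (ℚᵘ.≤-respˡ-≃ (ℚᵘ.≃-sym (toℚᵘ-/suc x 0)) (ℚᵘ.≤-respʳ-≃ (ℚᵘ.≃-sym (toℚᵘ-/suc y 0))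
  (*≤* (subst₂ ℤ._≤_ (sym (ℤ.*-identityʳ (+ x))) (sym (ℤ.*-identityʳ (+ y))) (ℤ.+≤+ x≤y)))))

ι-suc-pos : ∀ d → ℚ.Positive (ι (suc d))
ι-suc-pos d = normalize-pos (suc d) 1

/suc*ι-suc : ∀ x d → ((+ x) / suc d) *ℚ ι (suc d) ≡ ι x
/suc*ι-suc x d = toℚᵘ-injective (ℚᵘ.≃-trans (toℚᵘ-homo-* ((+ x) / suc d) (ι (suc d)))
  (ℚᵘ.≃-trans (ℚᵘ.*-cong (toℚᵘ-/suc x d) (toℚᵘ-/suc (suc d) 0))
    (ℚᵘ.≃-sym (ℚᵘ.≃-trans (toℚᵘ-/suc x 0)
      (*≡* (trans (cong (λ z → + x ℤ.* + suc z) (*-identityʳ d)) (rearrange (+ x) (+ suc d))))))))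
  where
  rearrange : ∀ x d → x ℤ.* d ≡ (x ℤ.* d) ℤ.* + 1
  rearrange = ℤ-solve-∀

ι-*₃ : ∀ x y z → ι (x * y * z) ≡ ι x *ℚ ι y *ℚ ι z
ι-*₃ x y z = trans (ι-* (x * y) z) (cong (_*ℚ ι z) (ι-* x y))

-- Uq is passed with its value as an equation because rewriting inside the rational goal is
-- prohibitively slow.
clear-denominators : ∀ n c kc e A N P q {Uq} → Uq ≡ (+ P) / suc q →
  suc e * suc q * (n * c) + kc * n * suc q + kc * e * A * suc q ≤ suc e * suc q * N + kc * P →
  (ι (n * c) -ℚ (ι kc *ℚ (Uq -ℚ ι n)) *ℚ ((+ 1) / suc e)) +ℚ ((+ (kc * e)) / suc e) *ℚ ι A ≤ℚ ι N
clear-denominators n c kc e A N P q {Uq} refl L≤R = ℚ.*-cancelʳ-≤-pos T {{T-pos}} (begin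
  G *ℚ T                                ≡⟨ G*T≡L-kcP ⟩
  ι L -ℚ ι (kc * P)                     ≤⟨ ℚ.+-monoˡ-≤ (ℚ.- ι (kc * P)) (ι-mono L≤R) ⟩
  ι (R + kc * P) -ℚ ι (kc * P)          ≡⟨ cong (_-ℚ ι (kc * P)) (ι-+ R (kc * P)) ⟩
  (ι R +ℚ ι (kc * P)) -ℚ ι (kc * P)     ≡⟨ solve 2 (λ x y → (x :+ y) :- y := x) refl (ι R) (ι (kc * P)) ⟩
  ι R                                   ≡⟨ trans (ι-*₃ (suc e) (suc q) N) (ℚ.*-comm T (ι N)) ⟩
  ι N *ℚ T                              ∎)
  where
  open ℚ.≤-Reasoning
  open +-*-Solver
  iM = ι (suc e)
  iQ = ι (suc q)
  T = iM *ℚ iQ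
  T-pos : ℚ.Positive T
  T-pos = subst ℚ.Positive (ι-* (suc e) (suc q)) (ι-suc-pos (q + e * suc q))
  r = (+ 1) / suc e
  w = (+ (kc * e)) / suc e
  G = (ι (n * c) -ℚ (ι kc *ℚ (Uq -ℚ ι n)) *ℚ r) +ℚ w *ℚ ι A
  L = suc e * suc q * (n * c) + kc * n * suc q + kc * e * A * suc q
  R = suc e * suc q * N
  ιL≡ : ι L ≡ iM *ℚ iQ *ℚ ι (n * c) +ℚ ι kc *ℚ ι n *ℚ iQ +ℚ ι (kc * e) *ℚ ι A *ℚ iQ
  ιL≡ = begin-equality
    ι L
      ≡⟨ ι-+ (suc e * suc q * (n * c) + kc * n * suc q) (kc * e * A * suc q) ⟩
    ι (suc e * suc q * (n * c) + kc * n * suc q) +ℚ ι (kc * e * A * suc q)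
      ≡⟨ cong₂ _+ℚ_ (ι-+ (suc e * suc q * (n * c)) (kc * n * suc q)) (ι-*₃ (kc * e) A (suc q)) ⟩
    ι (suc e * suc q * (n * c)) +ℚ ι (kc * n * suc q) +ℚ ι (kc * e) *ℚ ι A *ℚ iQ
      ≡⟨ cong (_+ℚ ι (kc * e) *ℚ ι A *ℚ iQ) (cong₂ _+ℚ_ (ι-*₃ (suc e) (suc q) (n * c)) (ι-*₃ kc n (suc q))) ⟩
    iM *ℚ iQ *ℚ ι (n * c) +ℚ ι kc *ℚ ι n *ℚ iQ +ℚ ι (kc * e) *ℚ ι A *ℚ iQ ∎
  G*T≡L-kcP : G *ℚ T ≡ ι L -ℚ ι (kc * P)
  G*T≡L-kcP = begin-equality
    G *ℚ T
      ≡⟨ solve 9 (λ x k u y ρ m κ ω a →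
           ((x :- (k :* (u :- y)) :* ρ) :+ ω :* a) :* (m :* κ)
           := x :* m :* κ :- k :* (u :* κ) :* (ρ :* m) :+ k :* y :* κ :* (ρ :* m) :+ (ω :* m) :* a :* κ)
           refl (ι (n * c)) (ι kc) Uq (ι n) r iM iQ w (ι A) ⟩
    ι (n * c) *ℚ iM *ℚ iQ -ℚ ι kc *ℚ (Uq *ℚ iQ) *ℚ (r *ℚ iM) +ℚ ι kc *ℚ ι n *ℚ iQ *ℚ (r *ℚ iM) +ℚ (w *ℚ iM) *ℚ ι A *ℚ iQ
      ≡⟨ cong₂ (λ x y → ι (n * c) *ℚ iM *ℚ iQ -ℚ ι kc *ℚ x *ℚ y +ℚ ι kc *ℚ ι n *ℚ iQ *ℚ y +ℚ (w *ℚ iM) *ℚ ι A *ℚ iQ)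
           (/suc*ι-suc P q) (/suc*ι-suc 1 e) ⟩
    ι (n * c) *ℚ iM *ℚ iQ -ℚ ι kc *ℚ ι P *ℚ ι 1 +ℚ ι kc *ℚ ι n *ℚ iQ *ℚ ι 1 +ℚ (w *ℚ iM) *ℚ ι A *ℚ iQ
      ≡⟨ cong (λ z → ι (n * c) *ℚ iM *ℚ iQ -ℚ ι kc *ℚ ι P *ℚ ι 1 +ℚ ι kc *ℚ ι n *ℚ iQ *ℚ ι 1 +ℚ z *ℚ ι A *ℚ iQ)
           (/suc*ι-suc (kc * e) e) ⟩
    ι (n * c) *ℚ iM *ℚ iQ -ℚ ι kc *ℚ ι P *ℚ ι 1 +ℚ ι kc *ℚ ι n *ℚ iQ *ℚ ι 1 +ℚ ι (kc * e) *ℚ ι A *ℚ iQ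
      ≡⟨ solve 8 (λ x m κ k p y z a →
           x :* m :* κ :- k :* p :* con ℚ.1ℚ :+ k :* y :* κ :* con ℚ.1ℚ :+ z :* a :* κ
           := (m :* κ :* x :+ k :* y :* κ :+ z :* a :* κ) :- k :* p)
           refl (ι (n * c)) iM iQ (ι kc) (ι P) (ι n) (ι (kc * e)) (ι A) ⟩
    iM *ℚ iQ *ℚ ι (n * c) +ℚ ι kc *ℚ ι n *ℚ iQ +ℚ ι (kc * e) *ℚ ι A *ℚ iQ -ℚ ι kc *ℚ ι P
      ≡⟨ cong₂ _-ℚ_ ιL≡ (ι-* kc P) ⟨
    ι L -ℚ ι (kc * P) ∎

U≡ : ∀ m k c {q} → (k ∸ 1) C c ≡ suc q → U m k c ≡ (+ ((k ∸ 1) * (m C c))) / suc q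
U≡ m k c eq rewrite eq = refl

IsCBC⇒union-large : ∀ {n N a m X} → IsCBC n N (suc a) m X →
                    (I : Subset n) → ∣ I ∣ ≡ suc a → suc a ≤ ∣ unionOver X I ∣
IsCBC⇒union-large (_ , cbc) I ∣I∣≡1+a =
  subst (_≤ ∣ unionOver _ I ∣) ∣I∣≡1+a (cbc I (subst (1 ≤_) (sym ∣I∣≡1+a) (s≤s z≤n)) (≤-reflexive ∣I∣≡1+a))

cbc-bound-ℕ : ∀ {n N a m c} (X : Family n m) → IsCBC n N (suc a) m X → c ≤ a → suc a ≤ m →
  ∀ q → suc q ≡ a C c →
  suc (m ∸ suc a) * suc q * (n * c) + (suc a ∸ c) * n * suc q + (suc a ∸ c) * (m ∸ suc a) * countOfSize (suc a) X * suc q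
    ≤ suc (m ∸ suc a) * suc q * N + (suc a ∸ c) * (a * (m C c))
cbc-bound-ℕ {c = c} X cbc@(refl , _) c≤a k≤m q 1+q≡C
  with u , refl ← m≤n⇒∃[o]m+o≡n c≤a
  with e , refl ← m≤n⇒∃[o]m+o≡n k≤m
  rewrite m+n∸m≡n (suc (c + u)) e
        | trans (cong (_∸ c) (sym (+-suc c u))) (m+n∸m≡n c (suc u))
        | C≡binom (suc (c + u) + e) c
  -- Abstract binom (c + u) c in the bound rather than rewriting suc q in the goal, where
  -- some occurrences of suc q have already been unfolded by _*_.
  with binom (c + u) c | trans 1+q≡C (C≡binom (c + u) c) | cbc-bound-binom e c u X (IsCBC⇒union-large cbc)
... | _ | refl | bound = bound

lemma3p2 : (n N k m c : ℕ) → 1 ≤ n → 1 ≤ N → 1 ≤ k → 1 ≤ m → k ≤ m →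
           (X : Family n m) → IsCBC n N k m X →
           1 ≤ c → c ≤ k ∸ 1 →
           (((+ (n * c)) / 1)
             -ℚ ((((+ (k ∸ c)) / 1) *ℚ (U m k c -ℚ ((+ n) / 1))) *ℚ ((+ 1) / suc (m ∸ k))))
             +ℚ (((+ ((k ∸ c) * (m ∸ k))) / suc (m ∸ k)) *ℚ ((+ countOfSize k X) / 1))
           ≤ℚ ((+ N) / 1)
lemma3p2 n N (suc a) m c _ _ _ _ k≤m X cbc _ c≤a
  with q , 1+q≡C ← m≤n⇒∃[o]m+o≡n (subst (1 ≤_) (sym (C≡binom a c)) (binom-pos c≤a))
  = clear-denominators n c (suc a ∸ c) (m ∸ suc a) (countOfSize (suc a) X) N (a * (m C c)) q
      (U≡ m (suc a) c (sym 1+q≡C)) (cbc-bound-ℕ X cbc c≤a k≤m q 1+q≡C)
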